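{- Let $G$ be a $!$-graph and let $H$ be a full subgraph of $G$ (with restricted typing) such that $U(H)$ is a string graph. Then $H$ is a $!$-graph.
   Context: Fix a compressed monoidal signature $T=(O,M,\mathrm{dom},\mathrm{cod})$, with $\mathrm{dom},\mathrm{cod}: M \rightarrow (O\times\{\mathsf{v},\mathsf{f}\})^*$. The derived compressed typegraph $\mathcal{G}_T$ has vertex set $O\sqcup M$, a self-loop on each $X\in O$, an edge $\mathrm{in}^a_{f,i}$ from $X$ to $f$ for each $f\in M$ and index $i$ with $\mathrm{dom}(f)[i]=(X,a)$, and an edge $\mathrm{out}^a_{f,j}$ from $f$ to $X$ for each index $j$ with $\mathrm{cod}(f)[j]=(X,a)$. The $!$-typegraph $\mathcal{G}_{T!}$ is $\mathcal{G}_T$ together with a new vertex $!$, a self-loop on $!$, and an edge from $!$ to every vertex of $\mathcal{G}_T$. In a finite directed multigraph typed over $\mathcal{G}_{T!}$, vertices typed in $O$ are wire-vertices, those typed in $M$ node-vertices, those typed $!$ are $!$-vertices (set $!(G)$); an edge is fixed-arity if its type is tagged $\mathsf{f}$. $U$ deletes all $!$-vertices and their incident edges, giving a $\mathcal{G}_T$-typed graph. A string graph is a $\mathcal{G}_T$-typed graph whose typing restricts at each node-vertex $v$ to a bijection from fixed-arity edges at $v$ onto fixed-arity edges at its type, and in which each wire-vertex has at most one incoming and at most one outgoing edge. A subgraph $O'$ of a string graph $K$ that is itself a string graph is open if no vertex of $O'$ is adjacent in $K$ to a wire-vertex outside $O'$ and no fixed-arity edge of $K$ outside $O'$ is incident to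 a vertex of $O'$. For $b\in !(G)$, $B(b)$ is the full subgraph of $G$ on the successors of $b$ (vertices $v$ with an edge $b\rightarrow v$), and $\beta(G)$ is the full subgraph on $!(G)$. A $!$-graph is a $\mathcal{G}_{T!}$-typed graph $G$ such that (1) $U(G)$ is a string graph; (2) $\beta(G)$ is posetal: at most one edge between any two vertices, and the edge relation is reflexive, antisymmetric and transitive; (3) for every $b\in !(G)$, $U(B(b))$ is an open subgraph of $U(G)$; (4) for all $b,b'\in !(G)$, if $b'\in B(b)$ then $B(b')\subseteq B(b)$. -}

module Defs where

open import Data.Nat using (ℕ)
open import Data.Fin using (Fin)
open import Data.List using (List; length; lookup)
open import Data.Product using (Σ; _×_; _,_; proj₁; proj₂)
open import Data.Sum using (_⊎_)
open import Data.Empty using (⊥)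
open import Relation.Nullary using (¬_)
open import Relation.Binary.PropositionalEquality using (_≡_)

data Tag : Set where
  v f : Tag          -- 𝗏 (variable arity) and 𝖿 (fixed arity)

record Signature : Set₁ where
  field
    O   : Set
    M   : Set
    dom : M → List (O × Tag)
    cod : M → List (O × Tag)

module _ (T : Signature) where
  open Signature T

  -- The !-typegraph 𝒢_{T!}  (it contains 𝒢_T : vertices ob/mor, edges
  -- loopO / inE / outE)

  data TV : Set where
    ob   : O → TV
    mor  : M → TV
    bang : TV

  data TE : Set where
    loopO : O → TE
    inE   : (g : M) → Fin (length (dom g)) → TE
    outE  : (g : M) → Fin (length (cod g)) → TE
    loopB : TE
    bangO : O → TE
    bangM : M → TE

  tsrc : TE → TV
  tsrc (loopO X)  = ob X
  tsrc (inE g i)  = ob (proj₁ (lookup (dom g) i))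
  tsrc (outE g j) = mor g
  tsrc loopB      = bang
  tsrc (bangO X)  = bang
  tsrc (bangM g)  = bang

  ttgt : TE → TV
  ttgt (loopO X)  = ob X
  ttgt (inE g i)  = mor g
  ttgt (outE g j) = ob (proj₁ (lookup (cod g) j))
  ttgt loopB      = bang
  ttgt (bangO X)  = ob X
  ttgt (bangM g)  = mor g

  FixedT : TE → Set
  FixedT (loopO X)  = ⊥
  FixedT (inE g i)  = proj₂ (lookup (dom g) i) ≡ f
  FixedT (outE g j) = proj₂ (lookup (cod g) j) ≡ f
  FixedT loopB      = ⊥
  FixedT (bangO X)  = ⊥
  FixedT (bangM g)  = ⊥

  IncidentT : TE → TV → Set
  IncidentT t x = tsrc t ≡ x ⊎ ttgt t ≡ x

  record TGraph : Set where
    field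
      nV    : ℕ
      nE    : ℕ
      src   : Fin nE → Fin nV
      tgt   : Fin nE → Fin nV
      τV    : Fin nV → TV
      τE    : Fin nE → TE
      src-ok : ∀ e → tsrc (τE e) ≡ τV (src e)
      tgt-ok : ∀ e → ttgt (τE e) ≡ τV (tgt e)

  module _ (G : TGraph) where
    open TGraph G

    Vertex : Set
    Vertex = Fin nV

    Edge : Set
    Edge = Fin nE

    IsWire : Vertex → Set
    IsWire x = Σ O (λ X → τV x ≡ ob X)

    IsNode : Vertex → Set
    IsNode x = Σ M (λ g → τV x ≡ mor g)

    IsBang : Vertex → Set
    IsBang x = τV x ≡ bang

    -- vertices of U(G)
    NonBang : Vertex → Set
    NonBang x = ¬ IsBang x

    Fixed : Edge → Set
    Fixed e = FixedT (τE e)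

    Incident : Edge → Vertex → Set
    Incident e x = src e ≡ x ⊎ tgt e ≡ x

    -- Subgraphs of G considered below are full subgraphs, given by a
    -- predicate P on the vertices; e is an edge of the full subgraph on P:
    InFull : (Vertex → Set) → Edge → Set
    InFull P e = P (src e) × P (tgt e)

    -- The full subgraph of G on P (assumed to contain no !-vertices, so
    -- that it is 𝒢_T-typed) is a string graph.
    IsStringGraphOn : (Vertex → Set) → Set
    IsStringGraphOn P =
      -- at every node-vertex, typing restricts to a bijection from the
      -- fixed-arity edges at x onto the fixed-arity edges at its type
      (∀ x → P x → IsNode x →
         (∀ e e' → InFull P e → InFull P e' →
            Incident e x → Incident e' x → Fixed e → Fixed e' →
            τE e ≡ τE e' → e ≡ e')
       × (∀ t → FixedT t → IncidentT t (τV x) →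
            Σ Edge (λ e → InFull P e × Incident e x × τE e ≡ t)))
      × (∀ x → P x → IsWire x →
           (∀ e e' → InFull P e → InFull P e' →
              tgt e ≡ x → tgt e' ≡ x → e ≡ e')
         × (∀ e e' → InFull P e → InFull P e' →
              src e ≡ x → src e' ≡ x → e ≡ e'))

    IsOpenSubgraphOf : (Vertex → Set) → (Vertex → Set) → Set
    IsOpenSubgraphOf P' P =
      (∀ x → P' x → P x)
      × IsStringGraphOn P'
      × (∀ e → InFull P e →
           ((P' (src e) × IsWire (tgt e) × ¬ P' (tgt e)) → ⊥)
         × ((P' (tgt e) × IsWire (src e) × ¬ P' (src e)) → ⊥))
      × (∀ e x → InFull P e → ¬ InFull P' e → Fixed e →
           P' x → Incident e x → ⊥)

    Arrow : Vertex → Vertex → Set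
    Arrow a b = Σ Edge (λ e → src e ≡ a × tgt e ≡ b)

    -- vertices of B(b): the successors of b
    Succ : Vertex → Vertex → Set
    Succ b x = Arrow b x

    -- vertices of U(B(b))
    UB : Vertex → Vertex → Set
    UB b x = Succ b x × NonBang x

    IsPosetalβ : Set
    IsPosetalβ =
      (∀ e e' → IsBang (src e) → IsBang (tgt e) →
         src e ≡ src e' → tgt e ≡ tgt e' → e ≡ e')
      × (∀ a → IsBang a → Arrow a a)
      × (∀ a b → IsBang a → IsBang b → Arrow a b → Arrow b a → a ≡ b)
      × (∀ a b c → IsBang a → IsBang b → IsBang c →
           Arrow a b → Arrow b c → Arrow a c)

    record IsBangGraph : Set where
      field
        string  : IsStringGraphOn NonBang
        posetal : IsPosetalβ
        open-B  : ∀ b → IsBang b → IsOpenSubgraphOf (UB b) NonBang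
        nested  : ∀ b b' → IsBang b → IsBang b' → Succ b b' →
                    ∀ x → Succ b' x → Succ b x

  -- H is (up to the identification via ι) a full subgraph of G with the
  -- restricted typing: injective graph embedding that preserves typing
  -- and contains every edge of G between vertices of H.

  record FullSubgraph (H G : TGraph) : Set where
    private
      module H = TGraph H
      module G = TGraph G
    field
      ι      : Fin H.nV → Fin G.nV
      κ      : Fin H.nE → Fin G.nE
      ι-inj  : ∀ x y → ι x ≡ ι y → x ≡ y
      κ-inj  : ∀ e e' → κ e ≡ κ e' → e ≡ e'
      src-κ  : ∀ e → G.src (κ e) ≡ ι (H.src e)
      tgt-κ  : ∀ e → G.tgt (κ e) ≡ ι (H.tgt e)
      full   : ∀ (e : Fin G.nE) x y → G.src e ≡ ι x → G.tgt e ≡ ι y →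
                 Σ (Fin H.nE) (λ e' → κ e' ≡ e)
      τV-res : ∀ x → H.τV x ≡ G.τV (ι x)
      τE-res : ∀ e → H.τE e ≡ G.τE (κ e)

module Submission where

-- The proof transfers each !-graph axiom from G to H along the full embedding
-- ι : H ↪ G.  The embedding preserves and reflects vertex types and, because
-- it is full, also reflects edges: an edge of G between vertices of H comes
-- from an edge of H.  Hence the posetal structure of β and the nesting of the
-- sets B(b) restrict from G to H, and so do the two "openness" conditions on
-- U(B(b)).  The one axiom that does not transfer directly is that U(B(b)) is
-- itself a string graph; it follows from a general fact about a single graph
-- (`restrict-string`): inside a string graph, a decidable set of vertices
-- touched by no fixed-arity edge outside it spans a string graph, since every
-- fixed-arity edge demanded at one of its node-vertices lies inside it.

open import Defs
open import Data.Fin using (_≟_)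
open import Data.Fin.Properties using (any?)
open import Data.Product using (Σ; _×_; _,_; proj₁; proj₂)
open import Data.Sum using (inj₁; inj₂)
open import Data.Empty using (⊥; ⊥-elim)
open import Relation.Nullary using (¬_; Dec; yes; no)
open import Relation.Nullary.Decidable using (_×-dec_)
open import Relation.Binary.PropositionalEquality using (_≡_; sym; trans; cong; subst)

module SingleGraph (T : Signature) (G : TGraph T) where
  open TGraph G

  succ? : ∀ b x → Dec (Succ T G b x)
  succ? b x = any? (λ e → (src e ≟ b) ×-dec (tgt e ≟ x))

  -- Restricting a string graph to a (locally decidable) set of vertices P'
  -- that no fixed-arity edge leaves yields a string graph: injectivity
  -- conditions restrict trivially, and each fixed-arity edge required at a
  -- node-vertex of P' is an edge of P touching P', hence an edge of P'.
  restrict-string : {P P' : Vertex T G → Set} →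
    (∀ x → P' x → P x) →
    (∀ x → P x → Dec (P' x)) →
    (∀ e x → InFull T G P e → ¬ InFull T G P' e → Fixed T G e →
       P' x → Incident T G e x → ⊥) →
    IsStringGraphOn T G P → IsStringGraphOn T G P'
  restrict-string {P} {P'} P'⊆P P'? closed (nodes , wires) = nodes' , wires'
    where
    inP : ∀ {e} → InFull T G P' e → InFull T G P e
    inP (p , q) = P'⊆P _ p , P'⊆P _ q

    inP'? : ∀ e → InFull T G P e → Dec (InFull T G P' e)
    inP'? e (p , q) = P'? (src e) p ×-dec P'? (tgt e) q

    nodes' : ∀ x → P' x → IsNode T G x →
      (∀ e e' → InFull T G P' e → InFull T G P' e' → Incident T G e x → Incident T G e' x →
         Fixed T G e → Fixed T G e' → τE e ≡ τE e' → e ≡ e')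
      × (∀ t → FixedT T t → IncidentT T t (τV x) →
         Σ (Edge T G) (λ e → InFull T G P' e × Incident T G e x × τE e ≡ t))
    nodes' x p' node = (λ e e' i i' → proj₁ (nodes x (P'⊆P x p') node) e e' (inP i) (inP i'))
                     , demanded
      where
      demanded : ∀ t → FixedT T t → IncidentT T t (τV x) →
        Σ (Edge T G) (λ e → InFull T G P' e × Incident T G e x × τE e ≡ t)
      demanded t fixed-t inc-t with proj₂ (nodes x (P'⊆P x p') node) t fixed-t inc-t
      ... | e , i , inc , τe≡t with inP'? e i
      ...   | yes i' = e , i' , inc , τe≡t
      ...   | no ¬i' = ⊥-elim (closed e x i ¬i' (subst (FixedT T) (sym τe≡t) fixed-t) p' inc)

    wires' : ∀ x → P' x → IsWire T G x →
      (∀ e e' → InFull T G P' e → InFull T G P' e' → tgt e ≡ x → tgt e' ≡ x → e ≡ e')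
      × (∀ e e' → InFull T G P' e → InFull T G P' e' → src e ≡ x → src e' ≡ x → e ≡ e')
    wires' x p' wire =
        (λ e e' i i' → proj₁ (wires x (P'⊆P x p') wire) e e' (inP i) (inP i'))
      , (λ e e' i i' → proj₂ (wires x (P'⊆P x p') wire) e e' (inP i) (inP i'))

module Embedding (T : Signature) {H G : TGraph T} (FS : FullSubgraph T H G) where
  module G = TGraph G
  module H = TGraph H
  open FullSubgraph FS

  bang→ : ∀ x → IsBang T H x → IsBang T G (ι x)
  bang→ x b = trans (sym (τV-res x)) b

  bang← : ∀ x → IsBang T G (ι x) → IsBang T H x
  bang← x b = trans (τV-res x) b

  nonbang→ : ∀ x → NonBang T H x → NonBang T G (ι x)
  nonbang→ x nb b = nb (bang← x b)

  nonbang← : ∀ x → NonBang T G (ι x) → NonBang T H x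
  nonbang← x nb b = nb (bang→ x b)

  wire→ : ∀ x → IsWire T H x → IsWire T G (ι x)
  wire→ x (X , w) = X , trans (sym (τV-res x)) w

  fixed→ : ∀ e → Fixed T H e → Fixed T G (κ e)
  fixed→ e = subst (FixedT T) (τE-res e)

  incident→ : ∀ e x → Incident T H e x → Incident T G (κ e) (ι x)
  incident→ e x (inj₁ s) = inj₁ (trans (src-κ e) (cong ι s))
  incident→ e x (inj₂ t) = inj₂ (trans (tgt-κ e) (cong ι t))

  arrow→ : ∀ a b → Arrow T H a b → Arrow T G (ι a) (ι b)
  arrow→ a b (e , s , t) = κ e , trans (src-κ e) (cong ι s) , trans (tgt-κ e) (cong ι t)

  arrow← : ∀ a b → Arrow T G (ι a) (ι b) → Arrow T H a b
  arrow← a b (e , s , t) with full e a b s t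
  ... | e' , κe'≡e =
      e' , ι-inj _ _ (trans (sym (src-κ e')) (trans (cong G.src κe'≡e) s))
         , ι-inj _ _ (trans (sym (tgt-κ e')) (trans (cong G.tgt κe'≡e) t))

  ub→ : ∀ b x → UB T H b x → UB T G (ι b) (ι x)
  ub→ b x (s , nb) = arrow→ b x s , nonbang→ x nb

  ub← : ∀ b x → UB T G (ι b) (ι x) → UB T H b x
  ub← b x (s , nb) = arrow← b x s , nonbang← x nb

  src→ : {P : Vertex T H → Set} (Q : Vertex T G → Set) → (∀ x → P x → Q (ι x)) →
         ∀ e → P (H.src e) → Q (G.src (κ e))
  src→ Q P⇒Q e p = subst Q (sym (src-κ e)) (P⇒Q _ p)

  tgt→ : {P : Vertex T H → Set} (Q : Vertex T G → Set) → (∀ x → P x → Q (ι x)) →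
         ∀ e → P (H.tgt e) → Q (G.tgt (κ e))
  tgt→ Q P⇒Q e p = subst Q (sym (tgt-κ e)) (P⇒Q _ p)

  src← : {P : Vertex T H → Set} (Q : Vertex T G → Set) → (∀ x → Q (ι x) → P x) →
         ∀ e → Q (G.src (κ e)) → P (H.src e)
  src← Q Q⇒P e q = Q⇒P _ (subst Q (src-κ e) q)

  tgt← : {P : Vertex T H → Set} (Q : Vertex T G → Set) → (∀ x → Q (ι x) → P x) →
         ∀ e → Q (G.tgt (κ e)) → P (H.tgt e)
  tgt← Q Q⇒P e q = Q⇒P _ (subst Q (tgt-κ e) q)

  inFull→ : {P : Vertex T H → Set} (Q : Vertex T G → Set) → (∀ x → P x → Q (ι x)) →
            ∀ e → InFull T H P e → InFull T G Q (κ e)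
  inFull→ Q P⇒Q e (p , q) = src→ Q P⇒Q e p , tgt→ Q P⇒Q e q

  inFull← : {P : Vertex T H → Set} (Q : Vertex T G → Set) → (∀ x → Q (ι x) → P x) →
            ∀ e → InFull T G Q (κ e) → InFull T H P e
  inFull← Q Q⇒P e (p , q) = src← Q Q⇒P e p , tgt← Q Q⇒P e q

module Transfer (T : Signature) {G H : TGraph T} (BG : IsBangGraph T G)
                (FS : FullSubgraph T H G) (SH : IsStringGraphOn T H (NonBang T H)) where
  open FullSubgraph FS
  open Embedding T FS
  module BG = IsBangGraph BG

  -- β(H) is posetal: each condition holds at the image in β(G); the
  -- multiplicity and antisymmetry conditions pull back by injectivity.
  posetal : IsPosetalβ T H
  posetal with BG.posetal
  ... | singleG , reflexiveG , antisymG , transitiveG =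
    single , reflexive , antisym , transitive
    where

    single : ∀ e e' → IsBang T H (H.src e) → IsBang T H (H.tgt e) →
             H.src e ≡ H.src e' → H.tgt e ≡ H.tgt e' → e ≡ e'
    single e e' bs bt s≡s' t≡t' = κ-inj e e' (singleG (κ e) (κ e')
      (src→ (IsBang T G) bang→ e bs) (tgt→ (IsBang T G) bang→ e bt)
      (trans (src-κ e) (trans (cong ι s≡s') (sym (src-κ e'))))
      (trans (tgt-κ e) (trans (cong ι t≡t') (sym (tgt-κ e')))))

    reflexive : ∀ a → IsBang T H a → Arrow T H a a
    reflexive a ba = arrow← a a (reflexiveG (ι a) (bang→ a ba))

    antisym : ∀ a b → IsBang T H a → IsBang T H b → Arrow T H a b → Arrow T H b a → a ≡ b
    antisym a b ba bb ab ba' = ι-inj a b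
      (antisymG (ι a) (ι b) (bang→ a ba) (bang→ b bb) (arrow→ a b ab) (arrow→ b a ba'))

    transitive : ∀ a b c → IsBang T H a → IsBang T H b → IsBang T H c →
                 Arrow T H a b → Arrow T H b c → Arrow T H a c
    transitive a b c ba bb bc ab bc' = arrow← a c
      (transitiveG (ι a) (ι b) (ι c) (bang→ a ba) (bang→ b bb) (bang→ c bc)
                   (arrow→ a b ab) (arrow→ b c bc'))

  nested : ∀ b b' → IsBang T H b → IsBang T H b' → Succ T H b b' →
           ∀ x → Succ T H b' x → Succ T H b x
  nested b b' bb bb' bb'-arrow x b'x = arrow← b x
    (BG.nested (ι b) (ι b') (bang→ b bb) (bang→ b' bb')
               (arrow→ b b' bb'-arrow) (ι x) (arrow→ b' x b'x))

  open-B : ∀ b → IsBang T H b → IsOpenSubgraphOf T H (UB T H b) (NonBang T H)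
  open-B b bb with BG.open-B (ι b) (bang→ b bb)
  ... | _ , _ , no-wire-exitG , no-fixed-exitG =
    (λ _ → proj₂) , string-B , no-wire-exit , no-fixed-exit
    where
    open SingleGraph T H using (succ?; restrict-string)

    no-fixed-exit : ∀ e x → InFull T H (NonBang T H) e → ¬ InFull T H (UB T H b) e →
                    Fixed T H e → UB T H b x → Incident T H e x → ⊥
    no-fixed-exit e x inU ∉B fixed x∈B inc = no-fixed-exitG (κ e) (ι x)
      (inFull→ (NonBang T G) nonbang→ e inU) (λ i → ∉B (inFull← (UB T G (ι b)) (ub← b) e i))
      (fixed→ e fixed) (ub→ b x x∈B) (incident→ e x inc)

    no-wire-exit : ∀ e → InFull T H (NonBang T H) e →
        ((UB T H b (H.src e) × IsWire T H (H.tgt e) × ¬ UB T H b (H.tgt e)) → ⊥)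
      × ((UB T H b (H.tgt e) × IsWire T H (H.src e) × ¬ UB T H b (H.src e)) → ⊥)
    no-wire-exit e inU with no-wire-exitG (κ e) (inFull→ (NonBang T G) nonbang→ e inU)
    ... | no-exit-forwardG , no-exit-backwardG =
        (λ { (s∈B , wire , t∉B) → no-exit-forwardG
               ( src→ (UB T G (ι b)) (ub→ b) e s∈B
               , tgt→ (IsWire T G) wire→ e wire
               , λ t∈B → t∉B (tgt← (UB T G (ι b)) (ub← b) e t∈B)) })
      , (λ { (t∈B , wire , s∉B) → no-exit-backwardG
               ( tgt→ (UB T G (ι b)) (ub→ b) e t∈B
               , src→ (IsWire T G) wire→ e wire
               , λ s∈B → s∉B (src← (UB T G (ι b)) (ub← b) e s∈B)) })

    ub? : ∀ x → NonBang T H x → Dec (UB T H b x)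
    ub? x nb with succ? b x
    ... | yes s = yes (s , nb)
    ... | no ¬s = no (λ u → ¬s (proj₁ u))

    string-B : IsStringGraphOn T H (UB T H b)
    string-B = restrict-string (λ _ → proj₂) ub? no-fixed-exit SH

lemma4p6 : (T : Signature) (G H : TGraph T) →
    IsBangGraph T G →
    FullSubgraph T H G →
    IsStringGraphOn T H (NonBang T H) →
    IsBangGraph T H
lemma4p6 T G H BG FS SH = record
  { string  = SH
  ; posetal = posetal
  ; open-B  = open-B
  ; nested  = nested
  }
  where open Transfer T BG FS SH
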